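{- Let $\Gamma$ be a triangulation of a connected closed $2$-dimensional surface and $F$ a face of $\Gamma$. Then the $z$-monodromy $M_F$ is one of the following permutations of $\Omega(F)$: (M1) $M_F$ is the identity; (M2) $M_F=D_F$; (M3) $M_F=(-e_1,e_2,e_3)(-e_3,-e_2,e_1)$, where $(e_1,e_2,e_3)$ is one of the cycles of $D_F$; (M4) $M_F=(e_1,-e_2)(e_2,-e_1)$, where $(e_1,e_2,e_3)$ is one of the cycles of $D_F$ (and $e_3,-e_3$ are fixed points); (M5) $M_F=(D_F)^{ -1}$; (M6) $M_F=(-e_1,e_2,e_3)(-e_3,-e_2,e_1)$, where $(e_1,e_2,e_3)$ is one of the cycles of $(D_F)^{ -1}$; (M7) $M_F=(e_1,e_2)(-e_1,-e_2)$, where $(e_1,e_2,e_3)$ is one of the cycles of $D_F$ (and $e_3,-e_3$ are fixed points). Moreover, $\Gamma$ is locally $z$-knotted for $F$ if and only if one of the cases (M1)–(M4) holds.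
   Context: Let $\Gamma$ be a connected simple finite graph embedded in a connected closed $2$-dimensional surface such that every face (closure of a component of the complement) is a closed $2$-disc, every edge lies in exactly two distinct faces, two distinct faces meet in an edge, a vertex, or not at all, and every face has exactly three edges (a triangulation). Two distinct edges are adjacent if they share a vertex and lie in a common face. A zigzag is a sequence of edges $(e_i)_{i\in\mathbb N}$ with $e_i,e_{i+1}$ adjacent and the face containing $e_i,e_{i+1}$ distinct from the face containing $e_{i+1},e_{i+2}$, for all $i$; it is periodic and regarded as a cyclic sequence; it can be written as a cyclic sequence of vertices $v_1,\dots,v_n$ with $e_i$ joining $v_i,v_{i+1}$, so each passage of the zigzag through an edge has a direction (an oriented edge). A zigzag is determined by any two consecutive (oriented) edges; its reverse $Z^{ -1}$ is also a zigzag. For a face $F$ with vertices $a,b,c$, let $\Omega(F)=\{ab,bc,ca,ac,cb,ba\}$ be its oriented edges ($xy$ goes from $x$ to $y$), and for $e=xy$ write $-e=yx$. Let $D_F=(ab,bc,ca)(ac,cb,ba)$, i.e. $D_F(xy)=yz$ for distinct $x,y,z$. The $z$-monodromy $M_F:\Omega(F)\to\Omega(F)$ is defined by: for $e\in\Omega(F)$ take $e_0\in\Omega(F)$ with $D_F(e_0)=e$, take the zigzag $Z$ containing the consecutive oriented edges $e_0,e$, and let $M_F(e)$ be the first element of $\Omega(F)$ (oriented edge of $F$ in the direction traversed) occurring in $Z$ after $e$. Let $\mathcal Z(F)$ be the set of all zigzags containing a consecutive pair $e,D_F(e)$ with $e\in\Omega(F)$. $\Gamma$ is locally $z$-knotted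 for $F$ if $|\mathcal Z(F)|=2$. -}

module Defs where

open import Data.Nat using (ℕ; zero; suc; _+_; _≤_; _<_)
open import Data.Fin as Fin using (Fin)
open import Data.Product using (Σ; _×_; _,_)
open import Data.Sum using (_⊎_)
open import Relation.Nullary using (¬_; Dec)
open import Relation.Binary.PropositionalEquality using (_≡_; _≢_)
open import Relation.Binary.Construct.Closure.ReflexiveTransitive using (Star)

-- Faces are given by their (unordered) vertex sets,
-- encoded by a predicate IsFace x y z invariant under permutations.

record Triangulation (n : ℕ) : Set₁ where
  field
    IsFace    : Fin n → Fin n → Fin n → Set
    face?     : ∀ x y z → Dec (IsFace x y z)
    face-rot  : ∀ {x y z} → IsFace x y z → IsFace y z x
    face-swap : ∀ {x y z} → IsFace x y z → IsFace y x z
    face-distinct : ∀ {x y z} → IsFace x y z → x ≢ y × y ≢ z × z ≢ x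
    -- every edge lies in exactly two (distinct) faces
    edge-two : ∀ {x y z} → IsFace x y z →
      Σ (Fin n) λ w → w ≢ z × IsFace x y w ×
        (∀ u → IsFace x y u → u ≡ z ⊎ u ≡ w)
    -- the link of every vertex v is connected (hence a single cycle):
    -- closed-surface condition
    link-connected : ∀ {v u s u' s'} → IsFace v u s → IsFace v u' s' →
      Star (IsFace v) u u'
    connected : ∀ x y → Star (λ p q → Σ (Fin n) λ r → IsFace p q r) x y

module _ {n : ℕ} (T : Triangulation n) where
  open Triangulation T

  -- a zigzag, written as its vertex sequence v₀ v₁ v₂ … (edge eᵢ = vᵢvᵢ₊₁):
  -- consecutive edges are distinct, share a vertex and lie in a common
  -- face (the face {vᵢ,vᵢ₊₁,vᵢ₊₂}); consecutive such faces are distinct.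
  IsZigzag : (ℕ → Fin n) → Set
  IsZigzag w = ∀ i → IsFace (w i) (w (suc i)) (w (suc (suc i)))
                   × w (suc (suc (suc i))) ≢ w i

  -- equality of zigzags as cyclic sequences (one is a shift of the other)
  SameZigzag : (ℕ → Fin n) → (ℕ → Fin n) → Set
  SameZigzag w w' = Σ ℕ λ k → (∀ i → w' i ≡ w (k + i)) ⊎ (∀ i → w i ≡ w' (k + i))

-- Oriented edges Ω(F) of a face F with vertices a, b, c.

data OE : Set where
  ab bc ca ac cb ba : OE

-- which of a (0), b (1), c (2)
src tgt : OE → Fin 3
src ab = Fin.zero
src bc = Fin.suc Fin.zero
src ca = Fin.suc (Fin.suc Fin.zero)
src ac = Fin.zero
src cb = Fin.suc (Fin.suc Fin.zero)
src ba = Fin.suc Fin.zero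
tgt ab = Fin.suc Fin.zero
tgt bc = Fin.suc (Fin.suc Fin.zero)
tgt ca = Fin.zero
tgt ac = Fin.suc (Fin.suc Fin.zero)
tgt cb = Fin.suc Fin.zero
tgt ba = Fin.zero

D : OE → OE
D ab = bc
D bc = ca
D ca = ab
D ac = cb
D cb = ba
D ba = ac

Dinv : OE → OE
Dinv bc = ab
Dinv ca = bc
Dinv ab = ca
Dinv cb = ac
Dinv ba = cb
Dinv ac = ba

neg : OE → OE
neg ab = ba
neg ba = ab
neg bc = cb
neg cb = bc
neg ca = ac
neg ac = ca

module _ {n : ℕ} (a b c : Fin n) where

  vtx : Fin 3 → Fin n
  vtx Fin.zero = a
  vtx (Fin.suc Fin.zero) = b
  vtx (Fin.suc (Fin.suc Fin.zero)) = c

  IsOE : Fin n → Fin n → OE → Set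
  IsOE x y e = x ≡ vtx (src e) × y ≡ vtx (tgt e)

  InΩ : Fin n → Fin n → Set
  InΩ x y = Σ OE (IsOE x y)

module _ {n : ℕ} (T : Triangulation n) (a b c : Fin n) where
  open Triangulation T

  -- M is the z-monodromy M_F: for every e ∈ Ω(F), with e₀ = D_F⁻¹(e),
  -- and the zigzag w whose first two oriented edges are e₀, e,
  -- M(e) is the first oriented edge of F occurring in w after e.
  IsMonodromy : (OE → OE) → Set
  IsMonodromy M = ∀ (e : OE) (w : ℕ → Fin n) → IsZigzag T w →
    IsOE a b c (w 0) (w 1) (Dinv e) → IsOE a b c (w 1) (w 2) e →
    Σ ℕ λ k → 2 ≤ k × IsOE a b c (w k) (w (suc k)) (M e) ×
      (∀ j → 2 ≤ j → j < k → ¬ InΩ a b c (w j) (w (suc j)))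

  -- w ∈ Z(F): w contains consecutive oriented edges e, D_F(e), e ∈ Ω(F)
  InZF : (ℕ → Fin n) → Set
  InZF w = Σ ℕ λ i → Σ OE λ e →
    IsOE a b c (w i) (w (suc i)) e × IsOE a b c (w (suc i)) (w (suc (suc i))) (D e)

  -- |Z(F)| = 2 (zigzags counted as cyclic sequences)
  LocallyZKnotted : Set
  LocallyZKnotted = Σ (ℕ → Fin n) λ Z₁ → Σ (ℕ → Fin n) λ Z₂ →
    IsZigzag T Z₁ × InZF Z₁ × IsZigzag T Z₂ × InZF Z₂ ×
    ¬ SameZigzag T Z₁ Z₂ ×
    (∀ Z → IsZigzag T Z → InZF Z → SameZigzag T Z₁ Z ⊎ SameZigzag T Z₂ Z)

-- The seven types of z-monodromy.  Each permutation of the six-element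
-- set Ω(F) = {e₁,e₂,e₃,-e₁,-e₂,-e₃} is specified by its value on all six.

M1 M2 M3 M4 M5 M6 M7 : (OE → OE) → Set
M1 M = ∀ e → M e ≡ e
M2 M = ∀ e → M e ≡ D e
M3 M = Σ OE λ e₁ → let e₂ = D e₁ ; e₃ = D e₂ in
  (M (neg e₁) ≡ e₂ × M e₂ ≡ e₃ × M e₃ ≡ neg e₁) ×
  (M (neg e₃) ≡ neg e₂ × M (neg e₂) ≡ e₁ × M e₁ ≡ neg e₃)
M4 M = Σ OE λ e₁ → let e₂ = D e₁ ; e₃ = D e₂ in
  (M e₁ ≡ neg e₂ × M (neg e₂) ≡ e₁) ×
  (M e₂ ≡ neg e₁ × M (neg e₁) ≡ e₂) ×
  (M e₃ ≡ e₃ × M (neg e₃) ≡ neg e₃)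
M5 M = ∀ e → M e ≡ Dinv e
M6 M = Σ OE λ e₁ → let e₂ = Dinv e₁ ; e₃ = Dinv e₂ in
  (M (neg e₁) ≡ e₂ × M e₂ ≡ e₃ × M e₃ ≡ neg e₁) ×
  (M (neg e₃) ≡ neg e₂ × M (neg e₂) ≡ e₁ × M e₁ ≡ neg e₃)
M7 M = Σ OE λ e₁ → let e₂ = D e₁ ; e₃ = D e₂ in
  (M e₁ ≡ e₂ × M e₂ ≡ e₁) ×
  (M (neg e₁) ≡ neg e₂ × M (neg e₂) ≡ neg e₁) ×
  (M e₃ ≡ e₃ × M (neg e₃) ≡ neg e₃)

-- For an oriented edge e of F let Z e be the zigzag entering F along D⁻¹(e) and
-- continuing along e.  A zigzag is determined by three consecutive vertices, so
-- Z e is unique, and it is periodic (finitely many vertex triples); hence it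
-- returns to F, and the edge of its first return is M_F(e).  This gives the
-- existence of the z-monodromy.  For any z-monodromy M we then show:
--  * after returning along M e, the zigzag continues along D(M e), so from
--    there on it is Z (σ e) for σ = D ∘ M;
--  * entering F along -M e retraces Z e backwards, so M(-M e) = -e; and no
--    zigzag retraces itself, so M e ≠ -e (e ↦ -M e is a fixed-point-free
--    involution of Ω(F));
--  * the zigzags of Z(F) are the Z e, and Z e, Z f are the same zigzag only if
--    f lies in the σ-orbit of e, i.e. zigzags of Z(F) correspond to σ-orbits.
-- A finite computation over all maps Ω(F) → Ω(F) with the two properties of
-- the second point (fifteen survive) shows that each is of one of the types
-- (M1)–(M7), that σ has exactly two orbits for (M1)–(M4), and at least three
-- for (M5)–(M7).

module Submission where

open import Defs
open import Data.Nat as ℕ using (ℕ; zero; suc; _+_; _∸_; _*_; _≤_; _<_; z≤n; s≤s)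
open import Data.Nat.Properties
  using ( +-suc; +-comm; +-assoc; +-identityʳ; ≤-refl; ≤-trans; ≤-total; <⇒≤; <-cmp; n<1+n
        ; m≤n⇒∃[o]m+o≡n; m+[n∸m]≡n; m∸n+n≡m; m<n⇒0<n∸m; m<m+n; +-monoˡ-≤; anyUpTo? )
open import Data.Nat.Induction using (<-rec)
open import Data.Fin as Fin using (Fin)
import Data.Fin.Properties as Finₚ
open import Data.Fin.Patterns using (0F; 1F; 2F)
open import Data.Product using (Σ; _×_; _,_; proj₁; proj₂)
open import Data.Sum as Sum using (_⊎_; inj₁; inj₂)
open import Data.Empty using (⊥; ⊥-elim)
open import Function using (_∘_)
open import Function.Bundles using (_⇔_; mk⇔)
open import Relation.Nullary using (Dec; yes; no; ¬_; map′; ¬?; _×-dec_; _⊎-dec_; _→-dec_)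
open import Relation.Nullary.Decidable using (from-yes)
open import Relation.Unary using (Decidable)
open import Relation.Binary using (tri<; tri≈; tri>)
open import Relation.Binary.Definitions using (DecidableEquality)
open import Relation.Binary.PropositionalEquality

index : OE → ℕ
index ab = 0
index bc = 1
index ca = 2
index ac = 3
index cb = 4
index ba = 5

fromIndex : ℕ → OE
fromIndex 0 = ab
fromIndex 1 = bc
fromIndex 2 = ca
fromIndex 3 = ac
fromIndex 4 = cb
fromIndex _ = ba

fromIndex-index : ∀ e → fromIndex (index e) ≡ e
fromIndex-index = λ { ab → refl ; bc → refl ; ca → refl ; ac → refl ; cb → refl ; ba → refl }

infix 4 _≟_
_≟_ : DecidableEquality OE
e ≟ f = map′ index-injective (cong index) (index e ℕ.≟ index f)
  where
  index-injective : index e ≡ index f → e ≡ f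
  index-injective p = trans (sym (fromIndex-index e)) (trans (cong fromIndex p) (fromIndex-index f))

-- Quantifiers over the six-element set Ω(F) are decidable; with _≟_ this
-- lets finite facts about Ω(F) be established by evaluation ('from-yes').
∀? : {P : OE → Set} → Decidable P → Dec (∀ e → P e)
∀? P? = map′
  (λ (p₁ , p₂ , p₃ , p₄ , p₅ , p₆) → λ { ab → p₁ ; bc → p₂ ; ca → p₃ ; ac → p₄ ; cb → p₅ ; ba → p₆ })
  (λ p → p ab , p bc , p ca , p ac , p cb , p ba)
  (P? ab ×-dec P? bc ×-dec P? ca ×-dec P? ac ×-dec P? cb ×-dec P? ba)

∃? : {P : OE → Set} → Decidable P → Dec (Σ OE P)
∃? P? = map′
  (λ { (inj₁ p) → ab , p ; (inj₂ (inj₁ p)) → bc , p ; (inj₂ (inj₂ (inj₁ p))) → ca , p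
     ; (inj₂ (inj₂ (inj₂ (inj₁ p)))) → ac , p ; (inj₂ (inj₂ (inj₂ (inj₂ (inj₁ p))))) → cb , p
     ; (inj₂ (inj₂ (inj₂ (inj₂ (inj₂ p))))) → ba , p })
  (λ { (ab , p) → inj₁ p ; (bc , p) → inj₂ (inj₁ p) ; (ca , p) → inj₂ (inj₂ (inj₁ p))
     ; (ac , p) → inj₂ (inj₂ (inj₂ (inj₁ p))) ; (cb , p) → inj₂ (inj₂ (inj₂ (inj₂ (inj₁ p))))
     ; (ba , p) → inj₂ (inj₂ (inj₂ (inj₂ (inj₂ p)))) })
  (P? ab ⊎-dec P? bc ⊎-dec P? ca ⊎-dec P? ac ⊎-dec P? cb ⊎-dec P? ba)


ends-injective : ∀ e f → src e ≡ src f → tgt e ≡ tgt f → e ≡ f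
ends-injective = from-yes (∀? λ e → ∀? λ f →
  src e Fin.≟ src f →-dec tgt e Fin.≟ tgt f →-dec e ≟ f)

edge-between : ∀ i j → i ≢ j → Σ OE λ e → src e ≡ i × tgt e ≡ j
edge-between = from-yes (Finₚ.all? λ i → Finₚ.all? λ j →
  ¬? (i Fin.≟ j) →-dec ∃? λ e → src e Fin.≟ i ×-dec tgt e Fin.≟ j)

triangle-covers : ∀ e i → i ≡ src (Dinv e) ⊎ i ≡ src e ⊎ i ≡ tgt e
triangle-covers = from-yes (∀? λ e → Finₚ.all? λ i →
  i Fin.≟ src (Dinv e) ⊎-dec i Fin.≟ src e ⊎-dec i Fin.≟ tgt e)

src-D : ∀ e → src (D e) ≡ tgt e
src-D = λ { ab → refl ; bc → refl ; ca → refl ; ac → refl ; cb → refl ; ba → refl }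

Dinv-D : ∀ e → Dinv (D e) ≡ e
Dinv-D = λ { ab → refl ; bc → refl ; ca → refl ; ac → refl ; cb → refl ; ba → refl }

D-Dinv : ∀ e → D (Dinv e) ≡ e
D-Dinv = λ { ab → refl ; bc → refl ; ca → refl ; ac → refl ; cb → refl ; ba → refl }

src-neg : ∀ e → src (neg e) ≡ tgt e
src-neg = λ { ab → refl ; bc → refl ; ca → refl ; ac → refl ; cb → refl ; ba → refl }

tgt-neg : ∀ e → tgt (neg e) ≡ src e
tgt-neg = λ { ab → refl ; bc → refl ; ca → refl ; ac → refl ; cb → refl ; ba → refl }

src-Dinv-neg : ∀ e → src (Dinv (neg e)) ≡ tgt (D e)
src-Dinv-neg = λ { ab → refl ; bc → refl ; ca → refl ; ac → refl ; cb → refl ; ba → refl }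

tgt-D-neg : ∀ e → tgt (D (neg e)) ≡ src (Dinv e)
tgt-D-neg = λ { ab → refl ; bc → refl ; ca → refl ; ac → refl ; cb → refl ; ba → refl }

-- The first three iterates of e under a map τ : Ω(F) → Ω(F).  For the maps
-- arising below every orbit has at most three elements, and then Orbit₃ τ e
-- is the whole τ-orbit of e.
Orbit₃ : (OE → OE) → OE → OE → Set
Orbit₃ τ e x = x ≡ e ⊎ x ≡ τ e ⊎ x ≡ τ (τ e)

Short : (OE → OE) → OE → Set
Short τ e = Orbit₃ τ e (τ (τ (τ e)))

orbit₃-closed : ∀ {τ e x} → Short τ e → Orbit₃ τ e x → Orbit₃ τ e (τ x)
orbit₃-closed short (inj₁ refl)        = inj₂ (inj₁ refl)
orbit₃-closed short (inj₂ (inj₁ refl)) = inj₂ (inj₂ refl)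
orbit₃-closed short (inj₂ (inj₂ refl)) = short

Apart : (OE → OE) → OE → OE → Set
Apart τ e f = ¬ Orbit₃ τ e f × ¬ Orbit₃ τ f e

TwoOrbits : (OE → OE) → Set
TwoOrbits τ = Σ OE λ e₁ → Σ OE λ e₂ → Short τ e₁ × Short τ e₂ × Apart τ e₁ e₂ ×
  (∀ x → Orbit₃ τ e₁ x ⊎ Orbit₃ τ e₂ x)

ThreeOrbits : (OE → OE) → Set
ThreeOrbits τ = Σ OE λ e₁ → Σ OE λ e₂ → Σ OE λ e₃ → Short τ e₁ × Short τ e₂ × Short τ e₃ ×
  Apart τ e₁ e₂ × Apart τ e₁ e₃ × Apart τ e₂ e₃

orbit₃? : ∀ τ e x → Dec (Orbit₃ τ e x)
orbit₃? τ e x = x ≟ e ⊎-dec x ≟ τ e ⊎-dec x ≟ τ (τ e)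

apart? : ∀ τ e f → Dec (Apart τ e f)
apart? τ e f = ¬? (orbit₃? τ e f) ×-dec ¬? (orbit₃? τ f e)

two-orbits? : ∀ τ → Dec (TwoOrbits τ)
two-orbits? τ = ∃? λ e₁ → ∃? λ e₂ → orbit₃? τ e₁ _ ×-dec orbit₃? τ e₂ _ ×-dec apart? τ e₁ e₂ ×-dec
  ∀? λ x → orbit₃? τ e₁ x ⊎-dec orbit₃? τ e₂ x

three-orbits? : ∀ τ → Dec (ThreeOrbits τ)
three-orbits? τ = ∃? λ e₁ → ∃? λ e₂ → ∃? λ e₃ →
  orbit₃? τ e₁ _ ×-dec orbit₃? τ e₂ _ ×-dec orbit₃? τ e₃ _ ×-dec
  apart? τ e₁ e₂ ×-dec apart? τ e₁ e₃ ×-dec apart? τ e₂ e₃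

KnotType MonodromyType : (OE → OE) → Set
KnotType M = M1 M ⊎ M2 M ⊎ M3 M ⊎ M4 M
MonodromyType M = M1 M ⊎ M2 M ⊎ M3 M ⊎ M4 M ⊎ M5 M ⊎ M6 M ⊎ M7 M

-- The common shape of (M3) and (M6): (-e₁,e₂,e₃)(-e₃,-e₂,e₁) for a cycle
-- (e₁,e₂,e₃) of R; by definition M3 M is RotationShape D M and M6 M is
-- RotationShape Dinv M.
RotationShape : (OE → OE) → (OE → OE) → Set
RotationShape R M = Σ OE λ e₁ → let e₂ = R e₁ ; e₃ = R e₂ in
  (M (neg e₁) ≡ e₂ × M e₂ ≡ e₃ × M e₃ ≡ neg e₁) ×
  (M (neg e₃) ≡ neg e₂ × M (neg e₂) ≡ e₁ × M e₁ ≡ neg e₃)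

rotation-shape? : ∀ R M → Dec (RotationShape R M)
rotation-shape? R M = ∃? λ e₁ → let e₂ = R e₁ ; e₃ = R e₂ in
  (M (neg e₁) ≟ e₂ ×-dec M e₂ ≟ e₃ ×-dec M e₃ ≟ neg e₁) ×-dec
  (M (neg e₃) ≟ neg e₂ ×-dec M (neg e₂) ≟ e₁ ×-dec M e₁ ≟ neg e₃)

M4? : ∀ M → Dec (M4 M)
M4? M = ∃? λ e₁ → let e₂ = D e₁ ; e₃ = D e₂ in
  (M e₁ ≟ neg e₂ ×-dec M (neg e₂) ≟ e₁) ×-dec
  (M e₂ ≟ neg e₁ ×-dec M (neg e₁) ≟ e₂) ×-dec
  (M e₃ ≟ e₃ ×-dec M (neg e₃) ≟ neg e₃)

M7? : ∀ M → Dec (M7 M)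
M7? M = ∃? λ e₁ → let e₂ = D e₁ ; e₃ = D e₂ in
  (M e₁ ≟ e₂ ×-dec M e₂ ≟ e₁) ×-dec
  (M (neg e₁) ≟ neg e₂ ×-dec M (neg e₂) ≟ neg e₁) ×-dec
  (M e₃ ≟ e₃ ×-dec M (neg e₃) ≟ neg e₃)

knot-type? : ∀ M → Dec (KnotType M)
knot-type? M = ∀? (λ e → M e ≟ e) ⊎-dec ∀? (λ e → M e ≟ D e) ⊎-dec rotation-shape? D M ⊎-dec M4? M

monodromy-type? : ∀ M → Dec (MonodromyType M)
monodromy-type? M = ∀? (λ e → M e ≟ e) ⊎-dec ∀? (λ e → M e ≟ D e) ⊎-dec rotation-shape? D M ⊎-dec M4? M
  ⊎-dec ∀? (λ e → M e ≟ Dinv e) ⊎-dec rotation-shape? Dinv M ⊎-dec M7? M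

-- The two constraints proved below for every z-monodromy M: M(-M e) = -e and
-- M e ≠ -e.  Together they say that e ↦ -M e is a fixed-point-free
-- involution of Ω(F); there are fifteen such maps.
ReverseInvolutive NeverReverses : (OE → OE) → Set
ReverseInvolutive M = ∀ e → M (neg (M e)) ≡ neg e
NeverReverses M = ∀ e → M e ≢ neg e

Classified : (OE → OE) → Set
Classified M = MonodromyType M ×
  (KnotType M × TwoOrbits (D ∘ M) ⊎ ¬ KnotType M × ThreeOrbits (D ∘ M))

classified? : ∀ M → Dec (ReverseInvolutive M → NeverReverses M → Classified M)
classified? M = ∀? (λ e → M (neg (M e)) ≟ neg e) →-dec ∀? (λ e → ¬? (M e ≟ neg e)) →-dec
  monodromy-type? M ×-dec (knot-type? M ×-dec two-orbits? (D ∘ M) ⊎-dec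
                           ¬? (knot-type? M) ×-dec three-orbits? (D ∘ M))

table : OE → OE → OE → OE → OE → OE → OE → OE
table v₁ v₂ v₃ v₄ v₅ v₆ = λ { ab → v₁ ; bc → v₂ ; ca → v₃ ; ac → v₄ ; cb → v₅ ; ba → v₆ }

every-table-classified : ∀ v₁ v₂ v₃ v₄ v₅ v₆ → let M = table v₁ v₂ v₃ v₄ v₅ v₆ in
  ReverseInvolutive M → NeverReverses M → Classified M
every-table-classified = from-yes
  (∀? λ v₁ → ∀? λ v₂ → ∀? λ v₃ → ∀? λ v₄ → ∀? λ v₅ → ∀? λ v₆ → classified? (table v₁ v₂ v₃ v₄ v₅ v₆))

module _ {f g : OE → OE} (f≗g : ∀ e → f e ≡ g e) where
  private
    move : ∀ {x y} → f x ≡ y → g x ≡ y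
    move {x} p = trans (sym (f≗g x)) p

  rotation-resp : ∀ {R} → RotationShape R f → RotationShape R g
  rotation-resp (e₁ , (p , q , r) , (s , t , u)) = e₁ , (move p , move q , move r) , (move s , move t , move u)

  M4-resp : M4 f → M4 g
  M4-resp (e₁ , (p , q) , (r , s) , (t , u)) = e₁ , (move p , move q) , (move r , move s) , (move t , move u)

  M7-resp : M7 f → M7 g
  M7-resp (e₁ , (p , q) , (r , s) , (t , u)) = e₁ , (move p , move q) , (move r , move s) , (move t , move u)

  knot-type-resp : KnotType f → KnotType g
  knot-type-resp = Sum.map (λ h e → move (h e)) (Sum.map (λ h e → move (h e)) (Sum.map rotation-resp M4-resp))

  monodromy-type-resp : MonodromyType f → MonodromyType g
  monodromy-type-resp = Sum.map (λ h e → move (h e)) (Sum.map (λ h e → move (h e)) (Sum.map rotation-resp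
    (Sum.map M4-resp (Sum.map (λ h e → move (h e)) (Sum.map rotation-resp M7-resp)))))

module Zigzags {n : ℕ} (T : Triangulation n) where
  open Triangulation T

  face-rot² : ∀ {x y z} → IsFace x y z → IsFace z x y
  face-rot² = face-rot ∘ face-rot

  face-rev : ∀ {x y z} → IsFace x y z → IsFace z y x
  face-rev = face-swap ∘ face-rot

  face-xzy : ∀ {x y z} → IsFace x y z → IsFace x z y
  face-xzy = face-swap ∘ face-rot²

  other-face-unique : ∀ {x y z u u'} → IsFace x y z → IsFace x y u → IsFace x y u' →
    u ≢ z → u' ≢ z → u ≡ u'
  other-face-unique xyz xyu xyu' u≢z u'≢z with edge-two xyz
  ... | _ , _ , _ , only with only _ xyu | only _ xyu'
  ... | inj₁ u≡z | _         = ⊥-elim (u≢z u≡z)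
  ... | inj₂ _   | inj₁ u'≡z = ⊥-elim (u'≢z u'≡z)
  ... | inj₂ u≡w | inj₂ u'≡w = trans u≡w (sym u'≡w)

  Zig : (ℕ → Fin n) → Set
  Zig = IsZigzag T

  shift : ∀ {w} k → Zig w → Zig (λ t → w (t + k))
  shift k z t = z (t + k)

  -- w (3+i) is the third vertex of the face on w(1+i)w(2+i) other than the
  -- one containing w i, so it is determined by w i, w (1+i), w (2+i).
  next-determined : ∀ {w w'} → Zig w → Zig w' → ∀ i →
    w i ≡ w' i → w (1 + i) ≡ w' (1 + i) → w (2 + i) ≡ w' (2 + i) → w (3 + i) ≡ w' (3 + i)
  next-determined {w} {w'} z z' i p q r =
    other-face-unique (face-rot (proj₁ (z i))) (proj₁ (z (suc i)))
      (subst₂ (λ x y → IsFace x y (w' (3 + i))) (sym q) (sym r) (proj₁ (z' (suc i))))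
      (proj₂ (z i)) (λ u≡ → proj₂ (z' i) (trans u≡ p))

  prev-determined : ∀ {w w'} → Zig w → Zig w' → ∀ i j →
    w (1 + i) ≡ w' (1 + j) → w (2 + i) ≡ w' (2 + j) → w (3 + i) ≡ w' (3 + j) → w i ≡ w' j
  prev-determined {w} {w'} z z' i j p q r =
    other-face-unique (proj₁ (z (suc i))) (face-rot (proj₁ (z i)))
      (subst₂ (λ x y → IsFace x y (w' j)) (sym p) (sym q) (face-rot (proj₁ (z' j))))
      (λ u≡ → proj₂ (z i) (sym u≡)) (λ u≡ → proj₂ (z' j) (sym (trans u≡ r)))

  Agree : (ℕ → Fin n) → ℕ → (ℕ → Fin n) → ℕ → Set
  Agree w i w' j = ∀ t → w (t + i) ≡ w' (t + j)

  agree-forward : ∀ {w w'} → Zig w → Zig w' → ∀ i j →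
    w i ≡ w' j → w (1 + i) ≡ w' (1 + j) → w (2 + i) ≡ w' (2 + j) → Agree w i w' j
  agree-forward {w} {w'} z z' i j p q r t = proj₁ (go t)
    where
    go : ∀ t → w (t + i) ≡ w' (t + j) × w (1 + t + i) ≡ w' (1 + t + j) × w (2 + t + i) ≡ w' (2 + t + j)
    go zero = p , q , r
    go (suc t) with go t
    ... | p′ , q′ , r′ = q′ , r′ , next-determined (shift i z) (shift j z') t p′ q′ r′

  agree-backward : ∀ {w w'} → Zig w → Zig w' → ∀ d i j → Agree w (d + i) w' (d + j) → Agree w i w' j
  agree-backward z z' zero i j ag = ag
  agree-backward {w} {w'} z z' (suc d) i j ag = agree-backward z z' d i j one-step
    where
    one-step : Agree w (d + i) w' (d + j)
    one-step zero = prev-determined z z' (d + i) (d + j) (ag 0) (ag 1) (ag 2)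
    one-step (suc t) = trans (cong w (sym (+-suc t (d + i)))) (trans (ag t) (cong w' (+-suc t (d + j))))

  agree-sym : ∀ {w w' i j} → Agree w i w' j → Agree w' j w i
  agree-sym ag t = sym (ag t)

  Same : (ℕ → Fin n) → (ℕ → Fin n) → Set
  Same = SameZigzag T

  same-sym : ∀ {w w'} → Same w w' → Same w' w
  same-sym (k , inj₁ h) = k , inj₂ h
  same-sym (k , inj₂ h) = k , inj₁ h

  same-from-offset : ∀ {w w'} d → Agree w 0 w' d → Same w w'
  same-from-offset {w} {w'} d ag =
    d , inj₂ λ t → trans (cong w (sym (+-identityʳ t))) (trans (ag t) (cong w' (+-comm t d)))

  same-from-agree : ∀ {w w'} → Zig w → Zig w' → ∀ i j → Agree w i w' j → Same w w'
  same-from-agree {w} {w'} z z' i j ag with ≤-total i j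
  ... | inj₁ i≤j = let d , i+d≡j = m≤n⇒∃[o]m+o≡n i≤j in
    same-from-offset d (agree-backward z z' i 0 d
      (subst₂ (λ k l → Agree w k w' l) (sym (+-identityʳ i)) (sym i+d≡j) ag))
  ... | inj₂ j≤i = let d , j+d≡i = m≤n⇒∃[o]m+o≡n j≤i in
    same-sym (same-from-offset d (agree-backward z' z j 0 d
      (subst₂ (λ k l → Agree w' k w l) (sym (+-identityʳ j)) (sym j+d≡i) (agree-sym {w} {w'} {i} {j} ag))))

  same-to-agree : ∀ {w w'} → Same w w' → Σ ℕ λ i → Σ ℕ λ j → Agree w i w' j
  same-to-agree {w} {w'} (k , inj₁ h) =
    k , 0 , λ t → sym (trans (cong w' (+-identityʳ t)) (trans (h t) (cong w (+-comm k t))))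
  same-to-agree {w} {w'} (k , inj₂ h) =
    0 , k , λ t → trans (cong w (+-identityʳ t)) (trans (h t) (cong w' (+-comm k t)))

  same-trans : ∀ {u v w} → Zig u → Zig w → Same u v → Same v w → Same u w
  same-trans {u} {v} {w} zu zw uv vw with same-to-agree uv | same-to-agree vw
  ... | i , j , u≈v | k , l , v≈w = same-from-agree zu zw (k + i) (j + l) u≈w
    where
    open ≡-Reasoning
    u≈w : Agree u (k + i) w (j + l)
    u≈w t = begin
      u (t + (k + i)) ≡⟨ cong u (sym (+-assoc t k i)) ⟩
      u (t + k + i)   ≡⟨ u≈v (t + k) ⟩
      v (t + k + j)   ≡⟨ cong v (trans (+-assoc t k j) (trans (cong (t +_) (+-comm k j)) (sym (+-assoc t j k)))) ⟩
      v (t + j + k)   ≡⟨ v≈w (t + j) ⟩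
      w (t + j + l)   ≡⟨ cong w (+-assoc t j l) ⟩
      w (t + (j + l)) ∎

  same-from-common : ∀ {u v w} → Zig v → Zig w → Same u v → Same u w → Same v w
  same-from-common zv zw uv uw = same-trans zv zw (same-sym uv) uw

  -- Every zigzag is periodic: by pigeonhole two of the first n³+1 vertex
  -- triples coincide.
  periodic : ∀ {w} → Zig w → Σ ℕ λ d → 1 ≤ d × Agree w 0 w d
  periodic {w} z with Finₚ.pigeonhole (n<1+n (n * n * n)) triple
    where
    triple : Fin (suc (n * n * n)) → Fin (n * n * n)
    triple i = let t = Fin.toℕ i in Fin.combine (Fin.combine (w t) (w (1 + t))) (w (2 + t))
  ... | i , j , i<j , same-triple
    with m≤n⇒∃[o]m+o≡n i<j | Finₚ.combine-injective _ _ _ _ same-triple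
  ... | d , i+1+d≡j | first-two , w₂ with Finₚ.combine-injective _ _ _ _ first-two
  ... | w₀ , w₁ = suc d , s≤s z≤n , agree-backward z z I 0 (suc d)
        (subst₂ (λ k l → Agree w k w l) (sym (+-identityʳ I)) (sym (trans (+-suc I d) i+1+d≡j))
          (agree-forward z z I (Fin.toℕ j) w₀ w₁ w₂))
    where
    I : ℕ
    I = Fin.toℕ i

  reverse-agree : ∀ {w w'} → Zig w → Zig w' → ∀ k →
    w' 0 ≡ w (2 + k) → w' 1 ≡ w (1 + k) → w' 2 ≡ w k →
    ∀ i j → i + j ≡ k → w' i ≡ w (2 + j) × w' (1 + i) ≡ w (1 + j) × w' (2 + i) ≡ w j
  reverse-agree z z' k p q r zero j refl = p , q , r
  reverse-agree {w} {w'} z z' k p q r (suc i) j i+j≡k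
    with reverse-agree z z' k p q r i (suc j) (trans (+-suc i j) i+j≡k)
  ... | p′ , q′ , r′ = q′ , r′ ,
    other-face-unique (face-swap (proj₁ (z (suc j))))
      (subst₂ (λ x y → IsFace x y (w' (3 + i))) q′ r′ (proj₁ (z' (suc i))))
      (face-rev (proj₁ (z j)))
      (λ u≡ → proj₂ (z' i) (trans u≡ (sym p′)))
      (λ u≡ → proj₂ (z j) (sym u≡))

  halve : ∀ k → Σ ℕ λ m → m + m ≡ k ⊎ suc (m + m) ≡ k
  halve zero = 0 , inj₁ refl
  halve (suc k) with halve k
  ... | m , inj₁ even = m , inj₂ (cong suc even)
  ... | m , inj₂ odd  = suc m , inj₁ (trans (cong suc (+-suc m m)) (cong suc odd))

  -- No zigzag passes through three consecutive vertices and later through the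
  -- same vertices in reverse order: it would meet its own reversal in the
  -- middle, where two consecutive or second-next vertices would coincide.
  not-self-reverse : ∀ {w} → Zig w → ∀ k → w 0 ≡ w (2 + k) → w 1 ≡ w (1 + k) → w 2 ≡ w k → ⊥
  not-self-reverse z k p q r with halve k
  ... | m , inj₁ even =
    proj₂ (proj₂ (face-distinct (proj₁ (z m)))) (proj₂ (proj₂ (reverse-agree z z k p q r m m even)))
  ... | m , inj₂ odd =
    proj₁ (proj₂ (face-distinct (proj₁ (z m)))) (sym (proj₁ (proj₂ (reverse-agree z z k p q r (suc m) m odd))))

least : {P : ℕ → Set} → (∀ j → Dec (P j)) → ∀ m → P m → Σ ℕ λ k → P k × (∀ j → j < k → ¬ P j)
least {P} P? = <-rec (λ m → P m → Σ ℕ λ k → P k × (∀ j → j < k → ¬ P j)) search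
  where
  search : ∀ m → (∀ {j} → j < m → P j → Σ ℕ λ k → P k × (∀ j → j < k → ¬ P j)) →
    P m → Σ ℕ λ k → P k × (∀ j → j < k → ¬ P j)
  search m earlier pm with anyUpTo? P? m
  ... | no none = m , pm , λ j j<m pj → none (j , j<m , pj)
  ... | yes (j , j<m , pj) = earlier j<m pj

module Face {n : ℕ} (T : Triangulation n) (a b c : Fin n) (F : Triangulation.IsFace T a b c) where
  open Triangulation T
  open Zigzags T

  V : Fin 3 → Fin n
  V = vtx a b c

  Edge : Fin n → Fin n → OE → Set
  Edge = IsOE a b c

  OnF : Fin n → Fin n → Set
  OnF = InΩ a b c

  V-injective : ∀ i j → V i ≡ V j → i ≡ j
  V-injective i j Vi≡Vj with face-distinct F
  V-injective 0F 0F _ | _ = refl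
  V-injective 1F 1F _ | _ = refl
  V-injective 2F 2F _ | _ = refl
  V-injective 0F 1F a≡b | a≢b , _      = ⊥-elim (a≢b a≡b)
  V-injective 1F 0F b≡a | a≢b , _      = ⊥-elim (a≢b (sym b≡a))
  V-injective 1F 2F b≡c | _ , b≢c , _  = ⊥-elim (b≢c b≡c)
  V-injective 2F 1F c≡b | _ , b≢c , _  = ⊥-elim (b≢c (sym c≡b))
  V-injective 2F 0F c≡a | _ , _ , c≢a  = ⊥-elim (c≢a c≡a)
  V-injective 0F 2F a≡c | _ , _ , c≢a  = ⊥-elim (c≢a (sym a≡c))

  edge-unique : ∀ {x y e f} → Edge x y e → Edge x y f → e ≡ f
  edge-unique {e = e} {f} (xe , ye) (xf , yf) =
    ends-injective e f (V-injective _ _ (trans (sym xe) xf)) (V-injective _ _ (trans (sym ye) yf))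

  edge-reverse : ∀ {x y e} → Edge x y e → Edge y x (neg e)
  edge-reverse {e = e} (xe , ye) = trans ye (cong V (sym (src-neg e))) , trans xe (cong V (sym (tgt-neg e)))

  edge-of-vertices : ∀ {x y} i j → x ≡ V i → y ≡ V j → x ≢ y → OnF x y
  edge-of-vertices {x} {y} i j x≡ y≡ x≢y
    with edge-between i j (λ i≡j → x≢y (trans x≡ (trans (cong V i≡j) (sym y≡))))
  ... | e , src≡i , tgt≡j = e , trans x≡ (cong V (sym src≡i)) , trans y≡ (cong V (sym tgt≡j))

  onF? : ∀ x y → Dec (OnF x y)
  onF? x y = ∃? λ e → x Fin.≟ V (src e) ×-dec y Fin.≟ V (tgt e)

  face-along-D : ∀ e → IsFace (V (src e)) (V (tgt e)) (V (tgt (D e)))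
  face-along-D = λ { ab → F ; bc → face-rot F ; ca → face-rot² F
                   ; ac → face-xzy F ; cb → face-rev F ; ba → face-swap F }

  -- The canonical zigzags are generated by flags (faces with ordered
  -- vertices): from x,y,z go to y,z,u with yzu the other face on yz.
  Flag : Set
  Flag = Σ (Fin n × Fin n × Fin n) λ (x , y , z) → IsFace x y z

  advance : Flag → Flag
  advance ((x , y , z) , xyz) = (y , z , proj₁ other) , proj₁ (proj₂ (proj₂ other))
    where
    other : Σ (Fin n) λ u → u ≢ x × IsFace y z u × (∀ v → IsFace y z v → v ≡ x ⊎ v ≡ u)
    other = edge-two (face-rot xyz)

  flags : Flag → ℕ → Flag
  flags φ zero = φ
  flags φ (suc i) = advance (flags φ i)

  start : OE → Flag
  start ab = (c , a , b) , face-rot² F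
  start bc = (a , b , c) , F
  start ca = (b , c , a) , face-rot F
  start ac = (b , a , c) , face-swap F
  start cb = (a , c , b) , face-xzy F
  start ba = (c , b , a) , face-rev F

  Z : OE → ℕ → Fin n
  Z e i = proj₁ (proj₁ (flags (start e) i))

  Z-zigzag : ∀ e → Zig (Z e)
  Z-zigzag e i = proj₂ (flags (start e) i) , proj₁ (proj₂ (edge-two (face-rot (proj₂ (flags (start e) i)))))

  Passage : (ℕ → Fin n) → ℕ → OE → Set
  Passage w j e = Edge (w j) (w (1 + j)) (Dinv e) × Edge (w (1 + j)) (w (2 + j)) e

  Z-start : ∀ e → Passage (Z e) 0 e
  Z-start = λ { ab → (refl , refl) , (refl , refl) ; bc → (refl , refl) , (refl , refl)
              ; ca → (refl , refl) , (refl , refl) ; ac → (refl , refl) , (refl , refl)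
              ; cb → (refl , refl) , (refl , refl) ; ba → (refl , refl) , (refl , refl) }

  Z-unique : ∀ e {w} → Zig w → ∀ j → Passage w j e → ∀ t → Z e t ≡ w (t + j)
  Z-unique e z j ((w₀ , w₁) , (_ , w₂)) t with Z-start e
  ... | (z₀ , z₁) , (_ , z₂) = trans (cong (Z e) (sym (+-identityʳ t)))
    (agree-forward (Z-zigzag e) z 0 j (trans z₀ (sym w₀)) (trans z₁ (sym w₁)) (trans z₂ (sym w₂)) t)

  no-return-at-2 : ∀ e → ¬ OnF (Z e 2) (Z e 3)
  no-return-at-2 e (m , _ , z₃≡) with triangle-covers e (tgt m) | Z-start e
  ... | inj₁ i≡ | (z₀ , _) , _ = proj₂ (Z-zigzag e 0) (trans z₃≡ (trans (cong V i≡) (sym z₀)))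
  ... | inj₂ (inj₁ i≡) | _ , (z₁ , _) =
    proj₂ (proj₂ (face-distinct (proj₁ (Z-zigzag e 1)))) (trans z₃≡ (trans (cong V i≡) (sym z₁)))
  ... | inj₂ (inj₂ i≡) | _ , (_ , z₂) =
    proj₁ (proj₂ (face-distinct (proj₁ (Z-zigzag e 1)))) (sym (trans z₃≡ (trans (cong V i≡) (sym z₂))))

  FirstReturn : OE → ℕ → OE → Set
  FirstReturn e k f =
    2 ≤ k × Edge (Z e k) (Z e (1 + k)) f × (∀ j → 2 ≤ j → j < k → ¬ OnF (Z e j) (Z e (1 + j)))

  -- Z e returns to F, since it is periodic and starts on F.
  first-return : ∀ e → Σ ℕ λ k → Σ OE (FirstReturn e k)
  first-return e with periodic (Z-zigzag e)
  ... | d , 1≤d , period with least (λ j → 2 ℕ.≤? j ×-dec onF? (Z e j) (Z e (1 + j))) (1 + d)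
                             (s≤s 1≤d , e , subst₂ (λ x y → Edge x y e) (period 1) (period 2) (proj₂ (Z-start e)))
  ... | k , (2≤k , f , edge) , earlier = k , f , 2≤k , edge , λ j 2≤j j<k onF → earlier j j<k (2≤j , onF)

  Mc : OE → OE
  Mc e = proj₁ (proj₂ (first-return e))

  -- Any zigzag passing along D⁻¹(e), e first is Z e, so Mc is a z-monodromy.
  Mc-monodromy : IsMonodromy T a b c Mc
  Mc-monodromy e w z p₀ p₁ =
    let k , f , 2≤k , edge , earlier = first-return e in
    k , 2≤k , subst₂ (λ x y → Edge x y f) (along k) (along (1 + k)) edge ,
    λ j 2≤j j<k onF → earlier j 2≤j j<k (subst₂ OnF (sym (along j)) (sym (along (1 + j))) onF)
    where
    along : ∀ i → Z e i ≡ w i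
    along i = trans (Z-unique e z 0 (p₀ , p₁) i) (cong w (+-identityʳ i))

  onF-flip : ∀ {x y} → OnF x y → OnF y x
  onF-flip (e , edge) = neg e , edge-reverse edge

  module Monodromy (M : OE → OE) (isM : IsMonodromy T a b c M) where

    return-time : OE → ℕ
    return-time e = proj₁ (isM e (Z e) (Z-zigzag e) (proj₁ (Z-start e)) (proj₂ (Z-start e)))

    M-first-return : ∀ e → FirstReturn e (return-time e) (M e)
    M-first-return e = proj₂ (isM e (Z e) (Z-zigzag e) (proj₁ (Z-start e)) (proj₂ (Z-start e)))

    first-return-unique : ∀ e {k f} → FirstReturn e k f → M e ≡ f
    first-return-unique e {k} {f} (2≤k , edge , earlier) with M-first-return e
    ... | 2≤r , edgeM , earlierM with <-cmp k (return-time e)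
    ... | tri< k<r _ _ = ⊥-elim (earlierM k 2≤k k<r (f , edge))
    ... | tri≈ _ refl _ = edge-unique edgeM edge
    ... | tri> _ _ r<k = ⊥-elim (earlier _ 2≤r r<k (M e , edgeM))

    -- After returning along m, Z e leaves along D m: the third vertex of the
    -- next face is that of F, since the previous face is not F.
    continues-along-D : ∀ e {k m} → FirstReturn e k m → Edge (Z e (1 + k)) (Z e (2 + k)) (D m)
    continues-along-D e {1} (s≤s () , _)
    continues-along-D e {suc (suc zero)} (_ , edge , _) = ⊥-elim (no-return-at-2 e (_ , edge))
    continues-along-D e {suc (suc (suc j))} {m} (_ , (zk≡ , zk+1≡) , earlier) =
      trans zk+1≡ (cong V (sym (src-D m))) ,
      other-face-unique (face-rot (proj₁ (z k′))) (proj₁ (z k)) face-D (proj₂ (z k′)) third≢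
      where
      k′ k : ℕ
      k′ = 2 + j
      k = 3 + j
      z : Zig (Z e)
      z = Z-zigzag e
      face-D : IsFace (Z e k) (Z e (1 + k)) (V (tgt (D m)))
      face-D = subst₂ (λ x y → IsFace x y _) (sym zk≡) (sym zk+1≡) (face-along-D m)
      third≢ : V (tgt (D m)) ≢ Z e k′
      third≢ eq = earlier k′ (s≤s (s≤s z≤n)) ≤-refl
        (edge-of-vertices (tgt (D m)) (src m) (sym eq) zk≡ (proj₁ (face-distinct (proj₁ (z k′)))))

    -- Hence after its first return Z e continues as Z (σ e), σ = D ∘ M.
    σ : OE → OE
    σ e = D (M e)

    M-passage : ∀ e → Passage (Z e) (return-time e) (σ e)
    M-passage e = subst (Edge _ _) (sym (Dinv-D (M e))) (proj₁ (proj₂ (M-first-return e))) ,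
                  continues-along-D e (M-first-return e)

    Z-shift : ∀ e t → Z (σ e) t ≡ Z e (t + return-time e)
    Z-shift e = Z-unique (σ e) (Z-zigzag e) (return-time e) (M-passage e)

    -- M(-M e) = -e: entering F along -M e, Z (-M e) retraces Z e backwards and
    -- first returns along -e.
    M-reverse-involutive : ReverseInvolutive M
    M-reverse-involutive e = first-return-unique (neg m) (2≤k , at-k , none-before)
      where
      m : OE
      m = M e
      k : ℕ
      k = return-time e
      2≤k : 2 ≤ k
      2≤k = proj₁ (M-first-return e)
      edge-m : Edge (Z e k) (Z e (1 + k)) m
      edge-m = proj₁ (proj₂ (M-first-return e))
      earlier : ∀ j → 2 ≤ j → j < k → ¬ OnF (Z e j) (Z e (1 + j))
      earlier = proj₂ (proj₂ (M-first-return e))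
      start₀ : Z (neg m) 0 ≡ Z e (2 + k)
      start₀ = trans (proj₁ (proj₁ (Z-start (neg m))))
        (trans (cong V (src-Dinv-neg m)) (sym (proj₂ (continues-along-D e (M-first-return e)))))
      start₁ : Z (neg m) 1 ≡ Z e (1 + k)
      start₁ = trans (proj₁ (proj₂ (Z-start (neg m)))) (trans (cong V (src-neg m)) (sym (proj₂ edge-m)))
      start₂ : Z (neg m) 2 ≡ Z e k
      start₂ = trans (proj₂ (proj₂ (Z-start (neg m)))) (trans (cong V (tgt-neg m)) (sym (proj₁ edge-m)))
      backwards : ∀ i j → i + j ≡ k →
        Z (neg m) i ≡ Z e (2 + j) × Z (neg m) (1 + i) ≡ Z e (1 + j) × Z (neg m) (2 + i) ≡ Z e j
      backwards = reverse-agree (Z-zigzag e) (Z-zigzag (neg m)) k start₀ start₁ start₂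
      at-k : Edge (Z (neg m) k) (Z (neg m) (1 + k)) (neg e)
      at-k = let p , q , _ = backwards k 0 (+-identityʳ k) in
        subst₂ (λ x y → Edge x y (neg e)) (sym p) (sym q) (edge-reverse (proj₂ (Z-start e)))
      none-before : ∀ i → 2 ≤ i → i < k → ¬ OnF (Z (neg m) i) (Z (neg m) (1 + i))
      none-before i 2≤i i<k onF = earlier (1 + j) (s≤s (m<n⇒0<n∸m i<k)) 2+j≤k (onF-flip (subst₂ OnF p q onF))
        where
        j : ℕ
        j = k ∸ i
        i+j≡k : i + j ≡ k
        i+j≡k = m+[n∸m]≡n (<⇒≤ i<k)
        2+j≤k : 2 + j ≤ k
        2+j≤k = subst (2 + j ≤_) i+j≡k (+-monoˡ-≤ j 2≤i)
        p : Z (neg m) i ≡ Z e (2 + j)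
        p = proj₁ (backwards i j i+j≡k)
        q : Z (neg m) (1 + i) ≡ Z e (1 + j)
        q = proj₁ (proj₂ (backwards i j i+j≡k))

    -- M e ≠ -e: otherwise Z e would retrace itself after its first return.
    M-never-reverses : NeverReverses M
    M-never-reverses e Me≡−e = not-self-reverse (Z-zigzag e) k z₀ z₁ z₂
      where
      k : ℕ
      k = return-time e
      edge : Edge (Z e k) (Z e (1 + k)) (M e)
      edge = proj₁ (proj₂ (M-first-return e))
      after : Edge (Z e (1 + k)) (Z e (2 + k)) (D (M e))
      after = continues-along-D e (M-first-return e)
      z₀ : Z e 0 ≡ Z e (2 + k)
      z₀ = trans (proj₁ (proj₁ (Z-start e)))
        (trans (cong V (sym (tgt-D-neg e))) (trans (cong (V ∘ tgt ∘ D) (sym Me≡−e)) (sym (proj₂ after))))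
      z₁ : Z e 1 ≡ Z e (1 + k)
      z₁ = trans (proj₁ (proj₂ (Z-start e)))
        (trans (cong V (sym (tgt-neg e))) (trans (cong (V ∘ tgt) (sym Me≡−e)) (sym (proj₂ edge))))
      z₂ : Z e 2 ≡ Z e k
      z₂ = trans (proj₂ (proj₂ (Z-start e)))
        (trans (cong V (sym (src-neg e))) (trans (cong (V ∘ src) (sym Me≡−e)) (sym (proj₁ edge))))

    -- The zigzags of Z(F) correspond to the orbits of σ.  Orbits are described
    -- through the sets of oriented edges closed under σ.
    Closed : (OE → Set) → Set
    Closed P = ∀ e → P e → P (σ e)

    -- A σ-closed set containing e contains every f along which Z e passes
    -- through F: such passages happen at the start, or after the first return,
    -- where Z e continues as Z (σ e).
    passage-in-orbit : ∀ {P} → Closed P → ∀ j e f → P e → Passage (Z e) j f → P f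
    passage-in-orbit {P} closed = <-rec (λ j → ∀ e f → P e → Passage (Z e) j f → P f) step
      where
      step : ∀ j → (∀ {i} → i < j → ∀ e f → P e → Passage (Z e) i f → P f) →
        ∀ e f → P e → Passage (Z e) j f → P f
      step zero _ e f pe (_ , edge) = subst P (edge-unique (proj₂ (Z-start e)) edge) pe
      step (suc zero) _ e f _ (_ , edge) = ⊥-elim (no-return-at-2 e (f , edge))
      step j@(suc (suc _)) shorter e f pe (entry , edge) with <-cmp j (return-time e)
      ... | tri< j<r _ _ = ⊥-elim (proj₂ (proj₂ (M-first-return e)) j (s≤s (s≤s z≤n)) j<r (Dinv f , entry))
      ... | tri≈ _ j≡r _ = subst P (edge-unique (subst (λ k → Edge (Z e (1 + k)) (Z e (2 + k)) (σ e))
                               (sym j≡r) (proj₂ (M-passage e))) edge) (closed e pe)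
      ... | tri> _ _ r<j = shorter d<j (σ e) f (closed e pe) (along 0 entry , along 1 edge)
        where
        r d : ℕ
        r = return-time e
        d = j ∸ r
        d+r≡j : d + r ≡ j
        d+r≡j = m∸n+n≡m (<⇒≤ r<j)
        d<j : d < j
        d<j = subst (d <_) d+r≡j (m<m+n d (≤-trans (s≤s z≤n) (proj₁ (M-first-return e))))
        along : ∀ t {g} → Edge (Z e (t + j)) (Z e (1 + t + j)) g →
          Edge (Z (σ e) (t + d)) (Z (σ e) (1 + t + d)) g
        along t = subst₂ (λ x y → Edge x y _) (moved t) (moved (1 + t))
          where
          moved : ∀ s → Z e (s + j) ≡ Z (σ e) (s + d)
          moved s = sym (trans (Z-shift e (s + d)) (cong (Z e) (trans (+-assoc s d r) (cong (s +_) d+r≡j))))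

    not-a-shift : ∀ {P e f} → Closed P → P e → ¬ P f → ∀ k → ¬ (∀ i → Z f i ≡ Z e (k + i))
    not-a-shift {P} {e} {f} closed pe ¬pf k shifted =
      ¬pf (passage-in-orbit closed k e f pe (subst₂ (λ x y → Edge x y _) (at 0) (at 1) (proj₁ (Z-start f)) ,
                                             subst₂ (λ x y → Edge x y _) (at 1) (at 2) (proj₂ (Z-start f))))
      where
      at : ∀ i → Z f i ≡ Z e (i + k)
      at i = trans (shifted i) (cong (Z e) (+-comm k i))

    -- Z e and Z f are different zigzags if σ-closed sets separate them in both
    -- directions (a shift may go either way).
    distinct-zigzags : ∀ {P Q e f} → Closed P → Closed Q → P e → ¬ P f → Q f → ¬ Q e → ¬ Same (Z e) (Z f)
    distinct-zigzags cP cQ pe ¬pf qf ¬qe (k , inj₁ shifted) = not-a-shift cP pe ¬pf k shifted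
    distinct-zigzags cP cQ pe ¬pf qf ¬qe (k , inj₂ shifted) = not-a-shift cQ qf ¬qe k shifted

    Reach : OE → OE → Set
    Reach e f = Σ ℕ λ K → ∀ t → Z f t ≡ Z e (t + K)

    reach-refl : ∀ {e} → Reach e e
    reach-refl {e} = 0 , λ t → cong (Z e) (sym (+-identityʳ t))

    reach-step : ∀ {e f} → Reach e f → Reach e (σ f)
    reach-step {e} {f} (K , f≈e) = return-time f + K , λ t →
      trans (Z-shift f t) (trans (f≈e (t + return-time f)) (cong (Z e) (+-assoc t (return-time f) K)))

    Z-in-ZF : ∀ e → InZF T a b c (Z e)
    Z-in-ZF e =
      0 , Dinv e , proj₁ (Z-start e) , subst (Edge (Z e 1) (Z e 2)) (sym (D-Dinv e)) (proj₂ (Z-start e))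

    ZF-canonical : ∀ {W} → Zig W → InZF T a b c W → Σ OE λ f → Σ ℕ λ i → ∀ t → Z f t ≡ W (t + i)
    ZF-canonical z (i , e , entry , edge) =
      D e , i , Z-unique (D e) z i (subst (Edge _ _) (sym (Dinv-D e)) entry , edge)

    knotted-if : ∀ {P₁ P₂ e₁ e₂} → Closed P₁ → Closed P₂ → P₁ e₁ → ¬ P₁ e₂ → P₂ e₂ → ¬ P₂ e₁ →
      (∀ f → Reach e₁ f ⊎ Reach e₂ f) → LocallyZKnotted T a b c
    knotted-if {e₁ = e₁} {e₂} c₁ c₂ p₁ ¬p₁ p₂ ¬p₂ reach =
      Z e₁ , Z e₂ , Z-zigzag e₁ , Z-in-ZF e₁ , Z-zigzag e₂ , Z-in-ZF e₂ ,
      distinct-zigzags c₁ c₂ p₁ ¬p₁ p₂ ¬p₂ , covered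
      where
      covered : ∀ W → Zig W → InZF T a b c W → Same (Z e₁) W ⊎ Same (Z e₂) W
      covered W z inZF with ZF-canonical z inZF
      ... | f , i , f≈W = Sum.map (via e₁) (via e₂) (reach f)
        where
        via : ∀ e → Reach e f → Same (Z e) W
        via e (K , f≈e) = same-from-agree (Z-zigzag e) z K i (λ t → trans (sym (f≈e t)) (f≈W t))

    two-of-three-coincide : ∀ {Z₁ Z₂} → (∀ W → Zig W → InZF T a b c W → Same Z₁ W ⊎ Same Z₂ W) →
      ∀ e₁ e₂ e₃ → Same (Z e₁) (Z e₂) ⊎ Same (Z e₁) (Z e₃) ⊎ Same (Z e₂) (Z e₃)
    two-of-three-coincide cover e₁ e₂ e₃
      with cover (Z e₁) (Z-zigzag e₁) (Z-in-ZF e₁) | cover (Z e₂) (Z-zigzag e₂) (Z-in-ZF e₂)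
         | cover (Z e₃) (Z-zigzag e₃) (Z-in-ZF e₃)
    ... | inj₁ s₁ | inj₁ s₂ | _       = inj₁ (same-from-common (Z-zigzag e₁) (Z-zigzag e₂) s₁ s₂)
    ... | inj₂ s₁ | inj₂ s₂ | _       = inj₁ (same-from-common (Z-zigzag e₁) (Z-zigzag e₂) s₁ s₂)
    ... | inj₁ s₁ | inj₂ s₂ | inj₁ s₃ = inj₂ (inj₁ (same-from-common (Z-zigzag e₁) (Z-zigzag e₃) s₁ s₃))
    ... | inj₁ s₁ | inj₂ s₂ | inj₂ s₃ = inj₂ (inj₂ (same-from-common (Z-zigzag e₂) (Z-zigzag e₃) s₂ s₃))
    ... | inj₂ s₁ | inj₁ s₂ | inj₁ s₃ = inj₂ (inj₂ (same-from-common (Z-zigzag e₂) (Z-zigzag e₃) s₂ s₃))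
    ... | inj₂ s₁ | inj₁ s₂ | inj₂ s₃ = inj₂ (inj₁ (same-from-common (Z-zigzag e₁) (Z-zigzag e₃) s₁ s₃))

    not-knotted-if : ∀ {P₁ P₂ P₃ e₁ e₂ e₃} → Closed P₁ → Closed P₂ → Closed P₃ → P₁ e₁ → P₂ e₂ → P₃ e₃ →
      ¬ P₁ e₂ → ¬ P₁ e₃ → ¬ P₂ e₁ → ¬ P₂ e₃ → ¬ P₃ e₁ → ¬ P₃ e₂ → ¬ LocallyZKnotted T a b c
    not-knotted-if {e₁ = e₁} {e₂} {e₃} c₁ c₂ c₃ p₁ p₂ p₃ ¬p₁₂ ¬p₁₃ ¬p₂₁ ¬p₂₃ ¬p₃₁ ¬p₃₂
                   (_ , _ , _ , _ , _ , _ , _ , cover) =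
      Sum.[ distinct-zigzags c₁ c₂ p₁ ¬p₁₂ p₂ ¬p₂₁ ,
            Sum.[ distinct-zigzags c₁ c₃ p₁ ¬p₁₃ p₃ ¬p₃₁ , distinct-zigzags c₂ c₃ p₂ ¬p₂₃ p₃ ¬p₃₂ ] ]
        (two-of-three-coincide cover e₁ e₂ e₃)

    module _ {τ : OE → OE} (τ≗σ : ∀ e → τ e ≡ σ e) where

      orbit-closed : ∀ {e} → Short τ e → Closed (Orbit₃ τ e)
      orbit-closed short x x∈ = subst (Orbit₃ τ _) (τ≗σ x) (orbit₃-closed short x∈)

      orbit-reached : ∀ {e f} → Orbit₃ τ e f → Reach e f
      orbit-reached (inj₁ refl) = reach-refl
      orbit-reached (inj₂ (inj₁ refl)) = subst (Reach _) (sym (τ≗σ _)) (reach-step reach-refl)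
      orbit-reached {e} (inj₂ (inj₂ refl)) =
        subst (Reach e) (sym (trans (τ≗σ (τ e)) (cong σ (τ≗σ e)))) (reach-step (reach-step reach-refl))

      knotted-if-two-orbits : TwoOrbits τ → LocallyZKnotted T a b c
      knotted-if-two-orbits (_ , _ , short₁ , short₂ , (∉₁ , ∉₂) , cover) =
        knotted-if (orbit-closed short₁) (orbit-closed short₂) (inj₁ refl) ∉₁ (inj₁ refl) ∉₂
          (λ f → Sum.map orbit-reached orbit-reached (cover f))

      not-knotted-if-three-orbits : ThreeOrbits τ → ¬ LocallyZKnotted T a b c
      not-knotted-if-three-orbits (_ , _ , _ , s₁ , s₂ , s₃ , (∉₁₂ , ∉₂₁) , (∉₁₃ , ∉₃₁) , (∉₂₃ , ∉₃₂)) =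
        not-knotted-if (orbit-closed s₁) (orbit-closed s₂) (orbit-closed s₃) (inj₁ refl) (inj₁ refl) (inj₁ refl)
          ∉₁₂ ∉₁₃ ∉₂₁ ∉₂₃ ∉₃₁ ∉₃₂

    -- The classification of tables applies to M, whose two constraints were
    -- proved above, and transfers along M-table ≗ M.
    M-table : OE → OE
    M-table = table (M ab) (M bc) (M ca) (M ac) (M cb) (M ba)

    M-table≗M : ∀ e → M-table e ≡ M e
    M-table≗M = λ { ab → refl ; bc → refl ; ca → refl ; ac → refl ; cb → refl ; ba → refl }

    M-table-classified : Classified M-table
    M-table-classified = every-table-classified (M ab) (M bc) (M ca) (M ac) (M cb) (M ba)
      (λ e → trans (M-table≗M _) (trans (cong (M ∘ neg) (M-table≗M e)) (M-reverse-involutive e)))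
      (λ e t≡ → M-never-reverses e (trans (sym (M-table≗M e)) t≡))

    classification : MonodromyType M × (LocallyZKnotted T a b c ⇔ KnotType M)
    classification = from-table M-table-classified
      where
      from-table : Classified M-table → MonodromyType M × (LocallyZKnotted T a b c ⇔ KnotType M)
      from-table (type , inj₁ (knot , two)) =
        monodromy-type-resp M-table≗M type ,
        mk⇔ (λ _ → knot-type-resp M-table≗M knot) (λ _ → knotted-if-two-orbits (cong D ∘ M-table≗M) two)
      from-table (type , inj₂ (¬knot , three)) =
        monodromy-type-resp M-table≗M type ,
        mk⇔ (λ knotted → ⊥-elim (not-knotted-if-three-orbits (cong D ∘ M-table≗M) three knotted))
            (λ knot → ⊥-elim (¬knot (knot-type-resp (sym ∘ M-table≗M) knot)))

theorem2 : ∀ {n} (T : Triangulation n) (a b c : Fin n) →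
    Triangulation.IsFace T a b c →
    Σ (OE → OE) (IsMonodromy T a b c) ×
    (∀ M → IsMonodromy T a b c M →
      (M1 M ⊎ M2 M ⊎ M3 M ⊎ M4 M ⊎ M5 M ⊎ M6 M ⊎ M7 M) ×
      (LocallyZKnotted T a b c ⇔ (M1 M ⊎ M2 M ⊎ M3 M ⊎ M4 M)))
theorem2 T a b c F = (Mc , Mc-monodromy) , λ M isM → Monodromy.classification M isM
  where open Face T a b c F
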